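{- For all positive integers $k,n$, it holds that $$s^{(m)}_{k,n}=2s_{k,n}-s_{k,n+1}.$$
   Context: A finite nonempty set $F\subset\mathbb{N}$ is called Schreier if $\min F\ge|F|$ and maximal Schreier if $\min F=|F|$. For $k,n\in\mathbb{N}$, let $s_{k,n}$ be the number of sets $F\subset\{k,2k,\ldots,nk\}$ such that $F$ is Schreier and $nk\in F$, and let $s^{(m)}_{k,n}$ be the number of sets $F\subset\{k,2k,\ldots,nk\}$ such that $F$ is maximal Schreier and $nk\in F$. -}

module Defs where

open import Data.Nat using (ℕ; zero; suc; _*_; _≤_; _⊓_; _≟_; _≤?_)
open import Data.List using (List; []; _∷_; _++_; map; foldr; length; filter; upTo)
open import Data.List.Membership.Propositional using (_∈_)
open import Data.List.Membership.DecPropositional _≟_ using (_∈?_)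
open import Data.Product using (_×_)
open import Relation.Binary.PropositionalEquality using (_≡_)
open import Relation.Nullary using (¬_; Dec; yes; no)
open import Relation.Nullary.Decidable using (_×-dec_; ¬?)
open import Relation.Unary using (Decidable)
open import Data.List.Properties using (≡-dec)

-- All sub-lists (subsets) of a list; for a list without duplicates this
-- enumerates every subset exactly once.
subsets : List ℕ → List (List ℕ)
subsets [] = [] ∷ []
subsets (x ∷ xs) = subsets xs ++ map (x ∷_) (subsets xs)

-- minimum of a nonempty list (value on [] is irrelevant: Schreier sets are nonempty)
minL : List ℕ → ℕ
minL [] = 0
minL (x ∷ xs) = foldr _⊓_ x xs

multiples : ℕ → ℕ → List ℕ
multiples k n = map (λ i → suc i * k) (upTo n)

Schreier : List ℕ → Set
Schreier F = ¬ (F ≡ []) × (length F ≤ minL F)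

MaxSchreier : List ℕ → Set
MaxSchreier F = ¬ (F ≡ []) × (minL F ≡ length F)

schreier? : Decidable Schreier
schreier? F = ¬? (≡-dec _≟_ F []) ×-dec (length F ≤? minL F)

maxSchreier? : Decidable MaxSchreier
maxSchreier? F = ¬? (≡-dec _≟_ F []) ×-dec (minL F ≟ length F)

s : ℕ → ℕ → ℕ
s k n = length (filter (λ F → schreier? F ×-dec (n * k ∈? F)) (subsets (multiples k n)))

sm : ℕ → ℕ → ℕ
sm k n = length (filter (λ F → maxSchreier? F ×-dec (n * k ∈? F)) (subsets (multiples k n)))

-- Put L = {k, …, (n-1)k}, x = nk and y = (n+1)k; a set with maximum z is G ∪ {z} with G ⊆ L.
-- A Schreier set with maximum y either avoids x, and then replacing y by x changes neither its
-- size nor its minimum (x ≥ 1 takes care of G = ∅), or it is G ∪ {x, y}.  Hence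
-- s_{k,n+1} = s_{k,n} + B with B = #{G : G ∪ {x, y} Schreier}.  On the other hand G ∪ {x} is
-- Schreier iff min ≥ |G| + 1, which splits into min = |G| + 1 (maximal Schreier) and
-- min ≥ |G| + 2, i.e. G ∪ {x, y} Schreier; so s_{k,n} = s^{(m)}_{k,n} + B.
module Submission where

open import Defs
open import Data.Nat using (ℕ; _≤_; suc)
open import Data.Integer using (ℤ; +_; _-_; _*_)
open import Relation.Binary.PropositionalEquality using (_≡_)

open import Data.Bool using (Bool; true; false)
open import Data.Nat as ℕ using (zero; _+_; _<_; _⊓_; _≟_; _≤?_; z≤n; s≤s; NonZero)
open import Data.Nat.Properties
  using (+-commutativeSemigroup; +-assoc; +-comm; ⊓-comm; ⊓-assoc; m⊓n≤n; m≤n⇒m⊓n≡m;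
         ≤-refl; ≤-trans;
         <⇒≤; <-irrefl; <-trans; >⇒≢; ≤∧≢⇒<; n<1+n; *-monoˡ-<)
import Data.Integer as ℤ using (_+_)
open import Data.Integer.Properties using (pos-+)
open import Algebra.Properties.CommutativeSemigroup +-commutativeSemigroup
  renaming (interchange to +-interchange)
open import Data.Integer.Tactic.RingSolver using (solve-∀)
open import Data.List using (List; []; _∷_; _++_; _∷ʳ_; [_]; map; foldr; length; filter; upTo)
open import Data.List.Properties using (length-++; map-++; upTo-∷ʳ)
open import Data.List.Relation.Unary.All as All using (All; []; _∷_)
open import Data.List.Relation.Unary.All.Properties using (++⁺; map⁺; ∷ʳ⁺; all-upTo; All¬⇒¬Any)
open import Data.List.Membership.Propositional using (_∈_; _∉_)
open import Data.List.Membership.Propositional.Properties using (∈-++⁺ʳ)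
open import Data.List.Membership.DecPropositional _≟_ using (_∈?_)
open import Data.List.Relation.Unary.Any using (here)
open import Data.Product using (_,_; proj₂)
open import Function using (_∘_)
open import Function.Bundles using (mk⇔)
open import Relation.Binary.PropositionalEquality
  using (refl; sym; trans; subst; cong; cong₂; _≢_; module ≡-Reasoning)
open import Relation.Nullary using (Dec; yes; no; does; contradiction)
open import Relation.Nullary.Decidable using (dec-false; does-⇔; _×-dec_)
open import Relation.Unary using (Decidable)

open ≡-Reasoning

indicator : Bool → ℕ
indicator false = 0
indicator true  = 1

module _ {A : Set} where

  count : (A → Bool) → List A → ℕ
  count p []       = 0
  count p (a ∷ as) = indicator (p a) + count p as

  length-filter≡count : ∀ {P : A → Set} (P? : Decidable P) as →
                        length (filter P? as) ≡ count (does ∘ P?) as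
  length-filter≡count P? []       = refl
  length-filter≡count P? (a ∷ as) with does (P? a)
  ... | true  = cong suc (length-filter≡count P? as)
  ... | false = length-filter≡count P? as

  count-++ : ∀ p as bs → count p (as ++ bs) ≡ count p as + count p bs
  count-++ p []       bs = refl
  count-++ p (a ∷ as) bs =
    trans (cong (indicator (p a) ℕ.+_) (count-++ p as bs)) (sym (+-assoc (indicator (p a)) _ _))

  count-map : ∀ p (f : A → A) as → count p (map f as) ≡ count (p ∘ f) as
  count-map p f []       = refl
  count-map p f (a ∷ as) = cong (indicator (p (f a)) ℕ.+_) (count-map p f as)

  count-cong : ∀ {p q} {as} → All (λ a → p a ≡ q a) as → count p as ≡ count q as
  count-cong []         = refl
  count-cong (pq ∷ pqs) = cong₂ ℕ._+_ (cong indicator pq) (count-cong pqs)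

  count-false : ∀ {p} {as} → All (λ a → p a ≡ false) as → count p as ≡ 0
  count-false []         = refl
  count-false (pa ∷ pas) rewrite pa = count-false pas

  count-+ : ∀ {p q r} {as} →
            All (λ a → indicator (r a) ≡ indicator (p a) + indicator (q a)) as →
            count r as ≡ count p as + count q as
  count-+                 []         = refl
  count-+ {p} {q} {r} {a ∷ as} (ra ∷ ras) = begin
    indicator (r a) + count r as
      ≡⟨ cong₂ ℕ._+_ ra (count-+ ras) ⟩
    (indicator (p a) + indicator (q a)) + (count p as + count q as)
      ≡⟨ +-interchange (indicator (p a)) _ _ _ ⟩
    (indicator (p a) + count p as) + (indicator (q a) + count q as) ∎

count-subsets-∷ : ∀ p (x : ℕ) xs →
  count p (subsets (x ∷ xs)) ≡ count p (subsets xs) + count (p ∘ (x ∷_)) (subsets xs)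
count-subsets-∷ p x xs =
  trans (count-++ p (subsets xs) _) (cong (count p (subsets xs) ℕ.+_) (count-map p (x ∷_) (subsets xs)))

count-subsets-∷ʳ : ∀ p xs (y : ℕ) →
  count p (subsets (xs ∷ʳ y)) ≡ count p (subsets xs) + count (p ∘ (_∷ʳ y)) (subsets xs)
count-subsets-∷ʳ p []       y = count-subsets-∷ p y []
count-subsets-∷ʳ p (x ∷ xs) y = begin
  count p (subsets (x ∷ xs ∷ʳ y))
    ≡⟨ count-subsets-∷ p x (xs ∷ʳ y) ⟩
  count p (subsets (xs ∷ʳ y)) + count (p ∘ (x ∷_)) (subsets (xs ∷ʳ y))
    ≡⟨ cong₂ ℕ._+_ (count-subsets-∷ʳ p xs y) (count-subsets-∷ʳ (p ∘ (x ∷_)) xs y) ⟩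
  (count p (subsets xs) + count (p ∘ (_∷ʳ y)) (subsets xs))
    + (count (p ∘ (x ∷_)) (subsets xs) + count (p ∘ (x ∷_) ∘ (_∷ʳ y)) (subsets xs))
    ≡⟨ +-interchange (count p (subsets xs)) _ _ _ ⟩
  (count p (subsets xs) + count (p ∘ (x ∷_)) (subsets xs))
    + (count (p ∘ (_∷ʳ y)) (subsets xs) + count (p ∘ (_∷ʳ y) ∘ (x ∷_)) (subsets xs))
    ≡⟨ sym (cong₂ ℕ._+_ (count-subsets-∷ p x xs) (count-subsets-∷ (p ∘ (_∷ʳ y)) x xs)) ⟩
  count p (subsets (x ∷ xs)) + count (p ∘ (_∷ʳ y)) (subsets (x ∷ xs)) ∎

All-subsets : ∀ {P : ℕ → Set} {xs} → All P xs → All (All P) (subsets xs)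
All-subsets []         = [] ∷ []
All-subsets (px ∷ pxs) = ++⁺ (All-subsets pxs) (map⁺ (All.map (px ∷_) (All-subsets pxs)))

count-subsets-∷ʳ-fresh : ∀ p {xs} {y : ℕ} → (∀ {F} → y ∉ F → p F ≡ false) → All (y ≢_) xs →
  count p (subsets (xs ∷ʳ y)) ≡ count (p ∘ (_∷ʳ y)) (subsets xs)
count-subsets-∷ʳ-fresh p {xs} {y} p-fresh y∉xs = begin
  count p (subsets (xs ∷ʳ y))
    ≡⟨ count-subsets-∷ʳ p xs y ⟩
  count p (subsets xs) + count (p ∘ (_∷ʳ y)) (subsets xs)
    ≡⟨ cong (ℕ._+ count (p ∘ (_∷ʳ y)) (subsets xs)) (count-false no-subset-has-y) ⟩
  count (p ∘ (_∷ʳ y)) (subsets xs) ∎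
  where
  no-subset-has-y : All (λ F → p F ≡ false) (subsets xs)
  no-subset-has-y = All.map (p-fresh ∘ All¬⇒¬Any) (All-subsets y∉xs)

foldr-⊓-∷ʳ : ∀ g gs z → foldr _⊓_ g (gs ∷ʳ z) ≡ foldr _⊓_ g gs ⊓ z
foldr-⊓-∷ʳ g []       z = ⊓-comm z g
foldr-⊓-∷ʳ g (h ∷ gs) z = trans (cong (h ⊓_) (foldr-⊓-∷ʳ g gs z)) (sym (⊓-assoc h _ z))

minL-≤-head : ∀ g gs → minL (g ∷ gs) ≤ g
minL-≤-head g []       = ≤-refl
minL-≤-head g (h ∷ gs) = ≤-trans (m⊓n≤n h _) (minL-≤-head g gs)

minL-∷ʳ-≤ : ∀ F z → minL (F ∷ʳ z) ≤ z
minL-∷ʳ-≤ []       z = ≤-refl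
minL-∷ʳ-≤ (g ∷ gs) z rewrite foldr-⊓-∷ʳ g gs z = m⊓n≤n _ z

minL-∷ʳ : ∀ {F} z → F ≢ [] → minL F ≤ z → minL (F ∷ʳ z) ≡ minL F
minL-∷ʳ {[]}     z F≢[] _    = contradiction refl F≢[]
minL-∷ʳ {g ∷ gs} z _    F≤z = trans (foldr-⊓-∷ʳ g gs z) (m≤n⇒m⊓n≡m F≤z)

∷ʳ≢[] : ∀ (F : List ℕ) z → F ∷ʳ z ≢ []
∷ʳ≢[] []      z ()
∷ʳ≢[] (_ ∷ _) z ()

length-∷ʳ : ∀ (F : List ℕ) z → length (F ∷ʳ z) ≡ suc (length F)
length-∷ʳ F z = trans (length-++ F) (+-comm (length F) 1)

schreierWith : ℕ → List ℕ → Bool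
schreierWith z F = does (schreier? F ×-dec (z ∈? F))

maxSchreierWith : ℕ → List ℕ → Bool
maxSchreierWith z F = does (maxSchreier? F ×-dec (z ∈? F))

schreierCount : ℕ → List ℕ → ℕ
schreierCount z L = count (schreierWith z) (subsets L)

maxSchreierCount : ℕ → List ℕ → ℕ
maxSchreierCount z L = count (maxSchreierWith z) (subsets L)

schreierWith-∉ : ∀ {z F} → z ∉ F → schreierWith z F ≡ false
schreierWith-∉ {z} {F} z∉F = dec-false (schreier? F ×-dec (z ∈? F)) (z∉F ∘ proj₂)

maxSchreierWith-∉ : ∀ {z F} → z ∉ F → maxSchreierWith z F ≡ false
maxSchreierWith-∉ {z} {F} z∉F = dec-false (maxSchreier? F ×-dec (z ∈? F)) (z∉F ∘ proj₂)

∈-∷ʳ : ∀ F (z : ℕ) → z ∈ F ∷ʳ z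
∈-∷ʳ F z = ∈-++⁺ʳ F (here refl)

schreierWith-∷ʳ : ∀ z F → schreierWith z (F ∷ʳ z) ≡ does (suc (length F) ≤? minL (F ∷ʳ z))
schreierWith-∷ʳ z F = does-⇔ (mk⇔
  (λ ((_ , F≤min) , _) → subst (_≤ minL (F ∷ʳ z)) (length-∷ʳ F z) F≤min)
  (λ F<min → (∷ʳ≢[] F z , subst (_≤ minL (F ∷ʳ z)) (sym (length-∷ʳ F z)) F<min) , ∈-∷ʳ F z))
  (schreier? (F ∷ʳ z) ×-dec (z ∈? (F ∷ʳ z))) (suc (length F) ≤? minL (F ∷ʳ z))

maxSchreierWith-∷ʳ : ∀ z F → maxSchreierWith z (F ∷ʳ z) ≡ does (minL (F ∷ʳ z) ≟ suc (length F))
maxSchreierWith-∷ʳ z F = does-⇔ (mk⇔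
  (λ ((_ , min≡F) , _) → trans min≡F (length-∷ʳ F z))
  (λ min≡F → (∷ʳ≢[] F z , trans min≡F (sym (length-∷ʳ F z))) , ∈-∷ʳ F z))
  (maxSchreier? (F ∷ʳ z) ×-dec (z ∈? (F ∷ʳ z))) (minL (F ∷ʳ z) ≟ suc (length F))

indicator-≤-split : ∀ {a m} (a≤m? : Dec (a ≤ m)) (m≡a? : Dec (m ≡ a)) (a<m? : Dec (a < m)) →
  indicator (does a≤m?) ≡ indicator (does m≡a?) + indicator (does a<m?)
indicator-≤-split (yes _)   (yes refl) (yes a<a) = contradiction a<a (<-irrefl refl)
indicator-≤-split (yes _)   (yes _)    (no _)    = refl
indicator-≤-split (yes _)   (no _)     (yes _)   = refl
indicator-≤-split (yes a≤m) (no m≢a)   (no a≮m)  = contradiction (≤∧≢⇒< a≤m (m≢a ∘ sym)) a≮m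
indicator-≤-split (no a≰m)  (yes refl) _         = contradiction ≤-refl a≰m
indicator-≤-split (no a≰m)  (no _)     (yes a<m) = contradiction (<⇒≤ a<m) a≰m
indicator-≤-split (no _)    (no _)     (no _)    = refl

schreierWith-∷ʳ-split : ∀ {x y} F → x ≤ y →
  indicator (schreierWith x (F ∷ʳ x))
    ≡ indicator (maxSchreierWith x (F ∷ʳ x)) + indicator (schreierWith y (F ∷ʳ x ∷ʳ y))
schreierWith-∷ʳ-split {x} {y} F x≤y = begin
  indicator (schreierWith x (F ∷ʳ x))
    ≡⟨ cong indicator (schreierWith-∷ʳ x F) ⟩
  indicator (does (suc (length F) ≤? m))
    ≡⟨ indicator-≤-split (suc (length F) ≤? m) (m ≟ suc (length F)) (suc (suc (length F)) ≤? m) ⟩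
  indicator (does (m ≟ suc (length F))) + indicator (does (suc (suc (length F)) ≤? m))
    ≡⟨ sym (cong₂ ℕ._+_ (cong indicator (maxSchreierWith-∷ʳ x F)) (cong indicator top-removable)) ⟩
  indicator (maxSchreierWith x (F ∷ʳ x)) + indicator (schreierWith y (F ∷ʳ x ∷ʳ y)) ∎
  where
  m : ℕ
  m = minL (F ∷ʳ x)
  top-removable : schreierWith y (F ∷ʳ x ∷ʳ y) ≡ does (suc (suc (length F)) ≤? m)
  top-removable = trans (schreierWith-∷ʳ y (F ∷ʳ x))
    (cong₂ (λ l m → does (suc l ≤? m)) (length-∷ʳ F x)
           (minL-∷ʳ y (∷ʳ≢[] F x) (≤-trans (minL-∷ʳ-≤ F x) x≤y)))

schreierWith-∷ʳ-raise : ∀ {x y F} → 1 ≤ x → x ≤ y → All (_< x) F →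
  schreierWith y (F ∷ʳ y) ≡ schreierWith x (F ∷ʳ x)
schreierWith-∷ʳ-raise {x} {y} {[]} 1≤x x≤y [] = begin
  schreierWith y [ y ]  ≡⟨ schreierWith-∷ʳ y [] ⟩
  does (1 ≤? y)         ≡⟨ does-⇔ (mk⇔ (λ _ → 1≤x) (λ _ → ≤-trans 1≤x x≤y)) (1 ≤? y) (1 ≤? x) ⟩
  does (1 ≤? x)         ≡⟨ sym (schreierWith-∷ʳ x []) ⟩
  schreierWith x [ x ]  ∎
schreierWith-∷ʳ-raise {x} {y} {F@(g ∷ gs)} _ x≤y (g<x ∷ _) = begin
  schreierWith y (F ∷ʳ y)                  ≡⟨ schreierWith-∷ʳ y F ⟩
  does (suc (length F) ≤? minL (F ∷ʳ y))   ≡⟨ cong (λ m → does (suc (length F) ≤? m)) same-min ⟩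
  does (suc (length F) ≤? minL (F ∷ʳ x))   ≡⟨ sym (schreierWith-∷ʳ x F) ⟩
  schreierWith x (F ∷ʳ x)                  ∎
  where
  min≤x : minL F ≤ x
  min≤x = ≤-trans (minL-≤-head g gs) (<⇒≤ g<x)
  same-min : minL (F ∷ʳ y) ≡ minL (F ∷ʳ x)
  same-min = trans (minL-∷ʳ {F} y (λ ()) (≤-trans min≤x x≤y)) (sym (minL-∷ʳ {F} x (λ ()) min≤x))

m≡2[m+b]-[m+b+b] : ∀ m b → + m ≡ + 2 * + (m + b) - + (m + b + b)
m≡2[m+b]-[m+b+b] m b rewrite pos-+ (m + b) b | pos-+ m b = identity (+ m) (+ b)
  where
  identity : ∀ (m b : ℤ) → m ≡ + 2 * (m ℤ.+ b) - (m ℤ.+ b ℤ.+ b)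
  identity = solve-∀

maxSchreierCount-∷ʳ : ∀ {x y L} → 1 ≤ x → x < y → All (_< x) L →
  + maxSchreierCount x (L ∷ʳ x) ≡ + 2 * + schreierCount x (L ∷ʳ x) - + schreierCount y (L ∷ʳ x ∷ʳ y)
maxSchreierCount-∷ʳ {x} {y} {L} 1≤x x<y L<x = begin
  + maxSchreierCount x (L ∷ʳ x)
    ≡⟨ cong +_ maxCount-x ⟩
  + M
    ≡⟨ m≡2[m+b]-[m+b+b] M B ⟩
  + 2 * + (M + B) - + (M + B + B)
    ≡⟨ cong (λ a → + 2 * + a - + (a + B)) (sym A≡M+B) ⟩
  + 2 * + A - + (A + B)
    ≡⟨ cong₂ (λ a c → + 2 * + a - + c) (sym count-x) (sym count-y) ⟩
  + 2 * + schreierCount x (L ∷ʳ x) - + schreierCount y (L ∷ʳ x ∷ʳ y) ∎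
  where
  A M B : ℕ
  A = count (λ F → schreierWith x (F ∷ʳ x)) (subsets L)
  M = count (λ F → maxSchreierWith x (F ∷ʳ x)) (subsets L)
  B = count (λ F → schreierWith y (F ∷ʳ x ∷ʳ y)) (subsets L)

  x∉L : All (x ≢_) L
  x∉L = All.map >⇒≢ L<x

  y∉Lx : All (y ≢_) (L ∷ʳ x)
  y∉Lx = ∷ʳ⁺ (All.map (λ z<x → >⇒≢ (<-trans z<x x<y)) L<x) (>⇒≢ x<y)

  count-x : schreierCount x (L ∷ʳ x) ≡ A
  count-x = count-subsets-∷ʳ-fresh (schreierWith x) schreierWith-∉ x∉L

  maxCount-x : maxSchreierCount x (L ∷ʳ x) ≡ M
  maxCount-x = count-subsets-∷ʳ-fresh (maxSchreierWith x) maxSchreierWith-∉ x∉L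

  raise : ∀ {F} → All (_< x) F → schreierWith y (F ∷ʳ y) ≡ schreierWith x (F ∷ʳ x)
  raise = schreierWith-∷ʳ-raise 1≤x (<⇒≤ x<y)

  count-y : schreierCount y (L ∷ʳ x ∷ʳ y) ≡ A + B
  count-y = begin
    schreierCount y (L ∷ʳ x ∷ʳ y)
      ≡⟨ count-subsets-∷ʳ-fresh (schreierWith y) schreierWith-∉ y∉Lx ⟩
    count (λ F → schreierWith y (F ∷ʳ y)) (subsets (L ∷ʳ x))
      ≡⟨ count-subsets-∷ʳ (λ F → schreierWith y (F ∷ʳ y)) L x ⟩
    count (λ F → schreierWith y (F ∷ʳ y)) (subsets L) + B
      ≡⟨ cong (ℕ._+ B) (count-cong (All.map raise (All-subsets L<x))) ⟩
    A + B ∎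

  A≡M+B : A ≡ M + B
  A≡M+B = count-+ (All.universal (λ F → schreierWith-∷ʳ-split F (<⇒≤ x<y)) (subsets L))

multiples-suc : ∀ k m → multiples k (suc m) ≡ multiples k m ∷ʳ suc m ℕ.* k
multiples-suc k m = trans (cong (map (λ i → suc i ℕ.* k)) (sym (upTo-∷ʳ m))) (map-++ _ (upTo m) [ m ])

multiples-< : ∀ k m .{{_ : NonZero k}} → All (_< suc m ℕ.* k) (multiples k m)
multiples-< k m = map⁺ (All.map (λ i<m → *-monoˡ-< k (s≤s i<m)) (all-upTo m))

s≡schreierCount : ∀ k n → s k n ≡ schreierCount (n ℕ.* k) (multiples k n)
s≡schreierCount k n = length-filter≡count _ (subsets (multiples k n))

sm≡maxSchreierCount : ∀ k n → sm k n ≡ maxSchreierCount (n ℕ.* k) (multiples k n)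
sm≡maxSchreierCount k n = length-filter≡count _ (subsets (multiples k n))

theorem1p5 : (k n : ℕ) → 1 ≤ k → 1 ≤ n →
    + sm k n ≡ + 2 * + s k n - + s k (suc n)
theorem1p5 zero      _       () _
theorem1p5 _         zero    _  ()
theorem1p5 k@(suc _) (suc m) _ _ = begin
  + sm k (suc m)
    ≡⟨ cong +_ sm-x ⟩
  + maxSchreierCount x (L ∷ʳ x)
    ≡⟨ maxSchreierCount-∷ʳ (s≤s z≤n) x<y (multiples-< k m) ⟩
  + 2 * + schreierCount x (L ∷ʳ x) - + schreierCount y (L ∷ʳ x ∷ʳ y)
    ≡⟨ sym (cong₂ (λ a b → + 2 * + a - + b) s-x s-y) ⟩
  + 2 * + s k (suc m) - + s k (suc (suc m)) ∎
  where
  x y : ℕ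
  x = suc m ℕ.* k
  y = suc (suc m) ℕ.* k
  L : List ℕ
  L = multiples k m

  x<y : x < y
  x<y = *-monoˡ-< k (n<1+n (suc m))

  sm-x : sm k (suc m) ≡ maxSchreierCount x (L ∷ʳ x)
  sm-x = trans (sm≡maxSchreierCount k (suc m)) (cong (maxSchreierCount x) (multiples-suc k m))

  s-x : s k (suc m) ≡ schreierCount x (L ∷ʳ x)
  s-x = trans (s≡schreierCount k (suc m)) (cong (schreierCount x) (multiples-suc k m))

  s-y : s k (suc (suc m)) ≡ schreierCount y (L ∷ʳ x ∷ʳ y)
  s-y = trans (s≡schreierCount k (suc (suc m)))
              (cong (schreierCount y) (trans (multiples-suc k (suc m)) (cong (_∷ʳ y) (multiples-suc k m))))
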